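{- Let $\Sigma$, $\rho$, $E(x,y)$, $\mathbb Q$, $\mathbb{IQ}$ and $\mathcal I$ be as in the context, let $\mathbb R\subseteq\mathbb Q$ be a subquasivariety of $\mathbb Q$, and let $\mathbb{IR}$ be the quasivariety generated by $\{\mathcal I(A)\mid A\in\mathbb R\}$. If the interval functor $\mathcal I\colon\mathbb Q\to\mathbb{IQ}$ is a categorical equivalence, then its restriction to $\mathbb R$ is a categorical equivalence between $\mathbb R$ and $\mathbb{IR}$.
   Context: $\Sigma$ is a set of constant and function symbols containing constants $0,1$. A polarity $\rho$ assigns to each $n$-ary function symbol $f\in\Sigma$ a tuple $\rho(f)\in\{+,-\}^n$. A $\rho$-poalgebra is a pair $(A,\leq)$ with $A$ a $\Sigma$-algebra and $\leq$ a partial order such that each $f^A$ is monotone in its $k$-th argument if $\rho(f)_k=+$ and antitone if $\rho(f)_k=-$; it is bounded if $0^A\leq a\leq 1^A$ for all $a$. For a bounded $\rho$-poalgebra $A$, $\mathcal I(A)$ is the $(\Sigma\cup\{\Delta,\nabla,\iota\})$-algebra on $I(A)=\{[a,b]\mid a\leq b\}$ with $f^{\mathcal I(A)}([a_1,b_1],\dots,[a_n,b_n])=[f^A(c_1,\dots,c_n),f^A(d_1,\dots,d_n)]$, where $c_k=a_k,d_k=b_k$ if $\rho(f)_k=+$ and $c_k=b_k,d_k=a_k$ if $\rho(f)_k=-$, $\Delta[a,b]=[a,a]$, $\nabla[a,b]=[b,b]$, $\iota=[0^A,1^A]$. A set $E(x,y)$ of $\Sigma$-equations determines the order of $A$ if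 $a\leq b$ iff $t^A(a,b)=s^A(a,b)$ for all $t=s$ in $E(x,y)$. Standing assumptions: $\mathbb Q$ is a $\Sigma$-quasivariety of bounded $\rho$-poalgebras whose order is determined by a fixed set $E(x,y)$ of $\Sigma$-equations; $\mathbb{IQ}$ is the quasivariety generated by $\{\mathcal I(A)\mid A\in\mathbb Q\}$; categories have homomorphisms as morphisms. The interval functor sends $A\mapsto\mathcal I(A)$, $h\mapsto\mathcal I(h)$ with $\mathcal I(h)([a,b])=[h(a),h(b)]$. -}

module Defs where

open import Level using (Level) renaming (suc to lsuc)
open import Data.Nat using (ℕ; zero; suc)
open import Data.Fin using (Fin; zero; suc)
open import Data.Product using (Σ; Σ-syntax; _×_; _,_; proj₁; proj₂)
open import Data.List using (List)
open import Data.List.Relation.Unary.All using (All)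
open import Data.Empty using (⊥; ⊥-elim)
open import Relation.Binary.PropositionalEquality using (_≡_; refl; subst)
open import Relation.Binary using (IsEquivalence)
open import Function using (_∘_)

record Signature : Set₁ where
  field
    Op : Set
    ar : Op → ℕ

record Algebra (S : Signature) : Set₁ where
  open Signature S
  field
    Carrier : Set
    _≈_     : Carrier → Carrier → Set
    isEquiv : IsEquivalence _≈_
    ⟦_⟧     : (f : Op) → (Fin (ar f) → Carrier) → Carrier
    ⟦⟧-cong : ∀ f {as bs : Fin (ar f) → Carrier} → (∀ i → as i ≈ bs i) → ⟦ f ⟧ as ≈ ⟦ f ⟧ bs
  open IsEquivalence isEquiv public
    renaming (refl to ≈-refl; sym to ≈-sym; trans to ≈-trans)

open Algebra

data Term (S : Signature) (X : Set) : Set where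
  var : X → Term S X
  app : (f : Signature.Op S) → (Fin (Signature.ar S f) → Term S X) → Term S X

eval : ∀ {S X} (A : Algebra S) → (X → Carrier A) → Term S X → Carrier A
eval A env (var x)    = env x
eval A env (app f ts) = ⟦_⟧ A f (λ i → eval A env (ts i))

eval-cong : ∀ {S X} (A : Algebra S) {e e' : X → Carrier A} →
            (∀ x → _≈_ A (e x) (e' x)) → ∀ t → _≈_ A (eval A e t) (eval A e' t)
eval-cong A h (var x)    = h x
eval-cong A h (app f ts) = ⟦⟧-cong A f (λ i → eval-cong A h (ts i))

Equation : Signature → Set → Set
Equation S X = Term S X × Term S X

Holds : ∀ {S X} (A : Algebra S) → (X → Carrier A) → Equation S X → Set
Holds A env (t , s) = _≈_ A (eval A env t) (eval A env s)

record QuasiIdentity (S : Signature) : Set where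
  field
    premises   : List (Equation S ℕ)
    conclusion : Equation S ℕ

_⊨_ : ∀ {S} → Algebra S → QuasiIdentity S → Set
A ⊨ φ = ∀ (env : ℕ → Carrier A) →
        All (Holds A env) (QuasiIdentity.premises φ) → Holds A env (QuasiIdentity.conclusion φ)

Class : Signature → Set₂
Class S = Algebra S → Set₁

IsQuasivariety : ∀ {S} → Class S → Set₂
IsQuasivariety {S} K =
  Σ[ Φ ∈ (QuasiIdentity S → Set₁) ]
    (∀ A → (K A → ∀ φ → Φ φ → A ⊨ φ) × ((∀ φ → Φ φ → A ⊨ φ) → K A))

-- the quasivariety generated by a family of algebras:
-- all models of the quasi-identities valid in every member of the family
GeneratedBy : ∀ {S} {J : Set₁} → (J → Algebra S) → Class S
GeneratedBy {S} F B = ∀ (φ : QuasiIdentity S) → (∀ j → F j ⊨ φ) → B ⊨ φ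

record Hom {S : Signature} (A B : Algebra S) : Set where
  open Signature S
  field
    fun       : Carrier A → Carrier B
    fun-cong  : ∀ {a a'} → _≈_ A a a' → _≈_ B (fun a) (fun a')
    preserves : ∀ (f : Op) (as : Fin (ar f) → Carrier A) →
                _≈_ B (fun (⟦_⟧ A f as)) (⟦_⟧ B f (fun ∘ as))
open Hom

idH : ∀ {S} {A : Algebra S} → Hom A A
idH {A = A} = record { fun = λ a → a ; fun-cong = λ p → p ; preserves = λ f as → ≈-refl A }

_∘H_ : ∀ {S} {A B C : Algebra S} → Hom B C → Hom A B → Hom A C
_∘H_ {C = C} g f = record
  { fun = fun g ∘ fun f
  ; fun-cong = fun-cong g ∘ fun-cong f
  ; preserves = λ op as → ≈-trans C (fun-cong g (preserves f op as)) (preserves g op (fun f ∘ as)) }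

_≈H_ : ∀ {S} {A B : Algebra S} → Hom A B → Hom A B → Set
_≈H_ {B = B} f g = ∀ a → _≈_ B (fun f a) (fun g a)

Obj : ∀ {S} → Class S → Set₁
Obj {S} K = Σ (Algebra S) K

record Iso {S} (A B : Algebra S) : Set where
  field
    to      : Hom A B
    from    : Hom B A
    from∘to : (from ∘H to) ≈H idH
    to∘from : (to ∘H from) ≈H idH

record Functor {S T : Signature} (K : Class S) (L : Class T) : Set₁ where
  field
    obj    : Obj K → Obj L
    map    : ∀ {A B : Obj K} → Hom (proj₁ A) (proj₁ B) → Hom (proj₁ (obj A)) (proj₁ (obj B))
    map-cong : ∀ {A B : Obj K} {f g : Hom (proj₁ A) (proj₁ B)} → f ≈H g → map {A} {B} f ≈H map {A} {B} g
    map-id : ∀ {A : Obj K} → map {A} {A} (idH {A = proj₁ A}) ≈H idH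
    map-∘  : ∀ {A B C : Obj K} (g : Hom (proj₁ B) (proj₁ C)) (f : Hom (proj₁ A) (proj₁ B)) →
             map {A} {C} (g ∘H f) ≈H (map {B} {C} g ∘H map {A} {B} f)

record IsCatEquivalence {S T : Signature} {K : Class S} {L : Class T} (F : Functor K L) : Set₁ where
  open Functor
  field
    G     : Functor L K
    η     : ∀ (A : Obj K) → Iso (proj₁ A) (proj₁ (obj G (obj F A)))
    η-nat : ∀ {A B : Obj K} (f : Hom (proj₁ A) (proj₁ B)) →
            (Iso.to (η B) ∘H f) ≈H (map G {obj F A} {obj F B} (map F {A} {B} f) ∘H Iso.to (η A))
    ε     : ∀ (B : Obj L) → Iso (proj₁ (obj F (obj G B))) (proj₁ B)
    ε-nat : ∀ {B C : Obj L} (g : Hom (proj₁ B) (proj₁ C)) →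
            (Iso.to (ε C) ∘H map F {obj G B} {obj G C} (map G {B} {C} g)) ≈H (g ∘H Iso.to (ε B))

data Pol : Set where
  ⊕ ⊖ : Pol

record PolSig : Set₁ where
  field
    sig  : Signature
  open Signature sig public
  field
    𝟘 𝟙  : Op
    ar𝟘  : ar 𝟘 ≡ 0
    ar𝟙  : ar 𝟙 ≡ 0
    ρ    : (f : Op) → Fin (ar f) → Pol

-- a set E(x,y) of equations in the two variables x = zero, y = suc zero
record OrderEqs (S : Signature) : Set₁ where
  field
    Idx : Set
    lhs rhs : Idx → Term S (Fin 2)

fin0 : Fin 0 → ⊥
fin0 ()

noArgs : ∀ {n} {C : Set} → n ≡ 0 → Fin n → C
noArgs e i = ⊥-elim (fin0 (subst Fin e i))

env2 : ∀ {C : Set} → C → C → Fin 2 → C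
env2 a b zero    = a
env2 a b (suc _) = b

upd : ∀ {n} {C : Set} → (Fin n → C) → Fin n → C → Fin n → C
upd a zero    x zero    = x
upd a zero    x (suc j) = a (suc j)
upd a (suc k) x zero    = a zero
upd a (suc k) x (suc j) = upd (a ∘ suc) k x j

cons : ∀ {n} {C : Set} → C → (Fin n → C) → Fin (suc n) → C
cons x v zero    = x
cons x v (suc j) = v j

PolRel : ∀ {C : Set} → (C → C → Set) → Pol → C → C → Set
PolRel _≤_ ⊕ x y = x ≤ y
PolRel _≤_ ⊖ x y = y ≤ x

selLo selHi : ∀ {C : Set} → Pol → C → C → C
selLo ⊕ a b = a
selLo ⊖ a b = b
selHi ⊕ a b = b
selHi ⊖ a b = a

module Joint {C : Set} (_≈_ _≤_ : C → C → Set)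
             (≈⇒≤ : ∀ {a b} → a ≈ b → a ≤ b)
             (≤-trans : ∀ {a b c} → a ≤ b → b ≤ c → a ≤ c) where

  resp : ∀ p {a a' b b'} → a ≈ a' → b ≈ b' → (sa : ∀ {x y} → x ≈ y → y ≈ x) →
         PolRel _≤_ p a b → PolRel _≤_ p a' b'
  resp ⊕ ea eb sy r = ≤-trans (≈⇒≤ (sy ea)) (≤-trans r (≈⇒≤ eb))
  resp ⊖ ea eb sy r = ≤-trans (≈⇒≤ (sy eb)) (≤-trans r (≈⇒≤ ea))

  joint : ∀ {n} (p : Fin n → Pol) (g : (Fin n → C) → C) →
          (∀ {as bs} → (∀ i → as i ≈ bs i) → g as ≈ g bs) →
          (∀ {x y : C} → x ≈ y → y ≈ x) →
          (∀ {x : C} → x ≈ x) →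
          (∀ a k x y → x ≤ y → PolRel _≤_ (p k) (g (upd a k x)) (g (upd a k y))) →
          ∀ c d → (∀ k → PolRel _≤_ (p k) (c k) (d k)) → g c ≤ g d
  joint {zero} p g gc sy rf gm c d h = ≈⇒≤ (gc (λ ()))
  joint {suc n} p g gc sy rf gm c d h =
      ≤-trans (≈⇒≤ (gc split)) (≤-trans step1 (≤-trans step2 (≈⇒≤ (gc split'))))
    where
    split : ∀ i → c i ≈ cons (c zero) (c ∘ suc) i
    split zero    = rf
    split (suc i) = rf
    split' : ∀ i → cons (d zero) (d ∘ suc) i ≈ d i
    split' zero    = rf
    split' (suc i) = rf
    g' : (Fin n → C) → C
    g' v = g (cons (c zero) v)
    g'c : ∀ {as bs} → (∀ i → as i ≈ bs i) → g' as ≈ g' bs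
    g'c e = gc (λ { zero → rf ; (suc i) → e i })
    eqU : ∀ v k x → ∀ i → cons (c zero) (upd v k x) i ≈ upd (cons (c zero) v) (suc k) x i
    eqU v k x zero    = rf
    eqU v k x (suc i) = rf
    g'm : ∀ a k x y → x ≤ y → PolRel _≤_ (p (suc k)) (g' (upd a k x)) (g' (upd a k y))
    g'm a k x y r = resp (p (suc k)) (sy (gc (eqU a k x))) (sy (gc (eqU a k y))) sy
                      (gm (cons (c zero) a) (suc k) x y r)
    step1 : g (cons (c zero) (c ∘ suc)) ≤ g (cons (c zero) (d ∘ suc))
    step1 = joint (p ∘ suc) g' g'c sy rf g'm (c ∘ suc) (d ∘ suc) (h ∘ suc)
    a0 : Fin (suc n) → C
    a0 = cons (c zero) (d ∘ suc)
    eq0 : ∀ x i → upd a0 zero x i ≈ cons x (d ∘ suc) i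
    eq0 x zero    = rf
    eq0 x (suc i) = rf
    step2' : ∀ q → PolRel _≤_ q (c zero) (d zero) →
             (∀ x y → x ≤ y → PolRel _≤_ q (g (upd a0 zero x)) (g (upd a0 zero y))) →
             g (cons (c zero) (d ∘ suc)) ≤ g (cons (d zero) (d ∘ suc))
    step2' ⊕ r m = ≤-trans (≈⇒≤ (sy (gc (eq0 (c zero)))))
                     (≤-trans (m (c zero) (d zero) r) (≈⇒≤ (gc (eq0 (d zero)))))
    step2' ⊖ r m = ≤-trans (≈⇒≤ (sy (gc (eq0 (c zero)))))
                     (≤-trans (m (d zero) (c zero) r) (≈⇒≤ (gc (eq0 (d zero)))))
    step2 : g (cons (c zero) (d ∘ suc)) ≤ g (cons (d zero) (d ∘ suc))
    step2 = step2' (p zero) (h zero) (gm a0 zero)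

module Interval (PS : PolSig) (E : OrderEqs (PolSig.sig PS)) where
  open PolSig PS
  open OrderEqs E

  Σ₀ : Signature
  Σ₀ = sig

  LeqE : (A : Algebra Σ₀) → Carrier A → Carrier A → Set
  LeqE A a b = ∀ i → _≈_ A (eval A (env2 a b) (lhs i)) (eval A (env2 a b) (rhs i))

  0ᴬ 1ᴬ : (A : Algebra Σ₀) → Carrier A
  0ᴬ A = ⟦_⟧ A 𝟘 (noArgs ar𝟘)
  1ᴬ A = ⟦_⟧ A 𝟙 (noArgs ar𝟙)

  record IsBPO (A : Algebra Σ₀) : Set where
    _≤_ = LeqE A
    field
      ≤-refl    : ∀ a → a ≤ a
      ≤-trans   : ∀ {a b c} → a ≤ b → b ≤ c → a ≤ c
      ≤-antisym : ∀ {a b} → a ≤ b → b ≤ a → _≈_ A a b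
      mono      : ∀ (f : Op) (as : Fin (ar f) → Carrier A) (k : Fin (ar f)) (x y : Carrier A) →
                  x ≤ y → PolRel _≤_ (ρ f k) (⟦_⟧ A f (upd as k x)) (⟦_⟧ A f (upd as k y))
      bottom    : ∀ a → 0ᴬ A ≤ a
      top       : ∀ a → a ≤ 1ᴬ A

  ≈⇒≤ : (A : Algebra Σ₀) → (∀ a → LeqE A a a) → ∀ {a b} → _≈_ A a b → LeqE A a b
  ≈⇒≤ A rf {a} {b} e i =
    ≈-trans A (eval-cong A pw (lhs i)) (≈-trans A (rf a i) (≈-sym A (eval-cong A pw (rhs i))))
    where
    pw : ∀ x → _≈_ A (env2 a b x) (env2 a a x)
    pw zero    = ≈-refl A
    pw (suc _) = ≈-sym A e

  data ExtOp : Set where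
    base  : Op → ExtOp
    Δ ∇ ι : ExtOp

  extAr : ExtOp → ℕ
  extAr (base f) = ar f
  extAr Δ = 1
  extAr ∇ = 1
  extAr ι = 0

  ΣI : Signature
  ΣI = record { Op = ExtOp ; ar = extAr }

  𝓘 : (A : Algebra Σ₀) → IsBPO A → Algebra ΣI
  𝓘 A P = record
    { Carrier = Σ[ ab ∈ Carrier A × Carrier A ] LeqE A (proj₁ ab) (proj₂ ab)
    ; _≈_ = λ x y → _≈_ A (proj₁ (proj₁ x)) (proj₁ (proj₁ y)) × _≈_ A (proj₂ (proj₁ x)) (proj₂ (proj₁ y))
    ; isEquiv = record
        { refl = ≈-refl A , ≈-refl A
        ; sym = λ (p , q) → ≈-sym A p , ≈-sym A q
        ; trans = λ (p , q) (p' , q') → ≈-trans A p p' , ≈-trans A q q' }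
    ; ⟦_⟧ = op
    ; ⟦⟧-cong = opc
    }
    where
    open IsBPO P
    module J = Joint (_≈_ A) (LeqE A) (≈⇒≤ A ≤-refl) ≤-trans
    I : Set
    I = Σ[ ab ∈ Carrier A × Carrier A ] LeqE A (proj₁ ab) (proj₂ ab)
    lo hi : I → Carrier A
    lo x = proj₁ (proj₁ x)
    hi x = proj₂ (proj₁ x)
    selOK : ∀ q (x : I) → PolRel (LeqE A) q (selLo q (lo x) (hi x)) (selHi q (lo x) (hi x))
    selOK ⊕ x = proj₂ x
    selOK ⊖ x = proj₂ x
    selCongLo : ∀ q {x y : I} → _≈_ A (lo x) (lo y) → _≈_ A (hi x) (hi y) →
                _≈_ A (selLo q (lo x) (hi x)) (selLo q (lo y) (hi y))
    selCongLo ⊕ p r = p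
    selCongLo ⊖ p r = r
    selCongHi : ∀ q {x y : I} → _≈_ A (lo x) (lo y) → _≈_ A (hi x) (hi y) →
                _≈_ A (selHi q (lo x) (hi x)) (selHi q (lo y) (hi y))
    selCongHi ⊕ p r = r
    selCongHi ⊖ p r = p
    op : (f : ExtOp) → (Fin (extAr f) → I) → I
    op (base f) xs =
      (⟦_⟧ A f (λ k → selLo (ρ f k) (lo (xs k)) (hi (xs k))) ,
       ⟦_⟧ A f (λ k → selHi (ρ f k) (lo (xs k)) (hi (xs k)))) ,
      J.joint (ρ f) (⟦_⟧ A f) (⟦⟧-cong A f) (≈-sym A) (≈-refl A) (mono f) _ _
              (λ k → selOK (ρ f k) (xs k))
    op Δ xs = (lo (xs zero) , lo (xs zero)) , ≤-refl _
    op ∇ xs = (hi (xs zero) , hi (xs zero)) , ≤-refl _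
    op ι xs = (0ᴬ A , 1ᴬ A) , bottom (1ᴬ A)
    opc : ∀ f {as bs : Fin (extAr f) → I} →
          (∀ i → (_≈_ A (lo (as i)) (lo (bs i))) × (_≈_ A (hi (as i)) (hi (bs i)))) →
          (_≈_ A (lo (op f as)) (lo (op f bs))) × (_≈_ A (hi (op f as)) (hi (op f bs)))
    opc (base f) {as} {bs} e =
      ⟦⟧-cong A f (λ k → selCongLo (ρ f k) {as k} {bs k} (proj₁ (e k)) (proj₂ (e k))) ,
      ⟦⟧-cong A f (λ k → selCongHi (ρ f k) {as k} {bs k} (proj₁ (e k)) (proj₂ (e k)))
    opc Δ e = proj₁ (e zero) , proj₁ (e zero)
    opc ∇ e = proj₂ (e zero) , proj₂ (e zero)
    opc ι e = ≈-refl A , ≈-refl A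

  hom-eval : ∀ {X} {A B : Algebra Σ₀} (h : Hom A B) (env : X → Carrier A) (t : Term Σ₀ X) →
             _≈_ B (fun h (eval A env t)) (eval B (fun h ∘ env) t)
  hom-eval {B = B} h env (var x) = ≈-refl B
  hom-eval {B = B} h env (app f ts) =
    ≈-trans B (preserves h f _) (⟦⟧-cong B f (λ i → hom-eval h env (ts i)))

  hom-mono : ∀ {A B : Algebra Σ₀} (h : Hom A B) {a b} → LeqE A a b → LeqE B (fun h a) (fun h b)
  hom-mono {A} {B} h {a} {b} r i =
    ≈-trans B (eval-cong B pw (lhs i))
      (≈-trans B (≈-sym B (hom-eval h (env2 a b) (lhs i)))
        (≈-trans B (fun-cong h (r i))
          (≈-trans B (hom-eval h (env2 a b) (rhs i)) (≈-sym B (eval-cong B pw (rhs i))))))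
    where
    pw : ∀ x → _≈_ B (env2 (fun h a) (fun h b) x) (fun h (env2 a b x))
    pw zero    = ≈-refl B
    pw (suc _) = ≈-refl B

  selLo-map : ∀ q {C D : Set} (h : C → D) a b → selLo q (h a) (h b) ≡ h (selLo q a b)
  selLo-map ⊕ h a b = refl
  selLo-map ⊖ h a b = refl
  selHi-map : ∀ q {C D : Set} (h : C → D) a b → selHi q (h a) (h b) ≡ h (selHi q a b)
  selHi-map ⊕ h a b = refl
  selHi-map ⊖ h a b = refl

  ≡⇒≈ : ∀ (B : Algebra Σ₀) {x y} → x ≡ y → _≈_ B x y
  ≡⇒≈ B refl = ≈-refl B

  𝓘map : ∀ {A B : Algebra Σ₀} (P : IsBPO A) (P' : IsBPO B) → Hom A B → Hom (𝓘 A P) (𝓘 B P')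
  𝓘map {A} {B} P P' h = record
    { fun = λ x → (fun h (proj₁ (proj₁ x)) , fun h (proj₂ (proj₁ x))) , hom-mono h (proj₂ x)
    ; fun-cong = λ (p , q) → fun-cong h p , fun-cong h q
    ; preserves = pres
    }
    where
    pres : ∀ (f : ExtOp) as → _
    pres (base f) as =
      ≈-trans B (preserves h f _)
        (⟦⟧-cong B f (λ k → ≡⇒≈ B (Relation.Binary.PropositionalEquality.sym
           (selLo-map (ρ f k) (fun h) (proj₁ (proj₁ (as k))) (proj₂ (proj₁ (as k))))))) ,
      ≈-trans B (preserves h f _)
        (⟦⟧-cong B f (λ k → ≡⇒≈ B (Relation.Binary.PropositionalEquality.sym
           (selHi-map (ρ f k) (fun h) (proj₁ (proj₁ (as k))) (proj₂ (proj₁ (as k)))))))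
    pres Δ as = ≈-refl B , ≈-refl B
    pres ∇ as = ≈-refl B , ≈-refl B
    pres ι as =
      ≈-trans B (preserves h 𝟘 _) (⟦⟧-cong B 𝟘 (λ i → ⊥-elim (fin0 (subst Fin ar𝟘 i)))) ,
      ≈-trans B (preserves h 𝟙 _) (⟦⟧-cong B 𝟙 (λ i → ⊥-elim (fin0 (subst Fin ar𝟙 i))))

  module _ (Q : Class Σ₀) (bpo : ∀ A → Q A → IsBPO A) where

    𝕀 : (K : Class Σ₀) → (∀ A → K A → Q A) → Class ΣI
    𝕀 K K⊆Q = GeneratedBy {J = Obj K} (λ j → 𝓘 (proj₁ j) (bpo (proj₁ j) (K⊆Q (proj₁ j) (proj₂ j))))

    𝓘F : (K : Class Σ₀) → (K⊆Q : ∀ A → K A → Q A) → Functor K (𝕀 K K⊆Q)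
    𝓘F K K⊆Q = record
      { obj = λ A → 𝓘 (proj₁ A) (P A) , (λ φ v → v A)
      ; map = λ {A} {B} h → 𝓘map (P A) (P B) h
      ; map-cong = λ {A} {B} e x → e (proj₁ (proj₁ x)) , e (proj₂ (proj₁ x))
      ; map-id = λ {A} x → ≈-refl (proj₁ A) , ≈-refl (proj₁ A)
      ; map-∘ = λ {A} {B} {C} g f x → ≈-refl (proj₁ C) , ≈-refl (proj₁ C)
      }
      where
      P : (A : Obj K) → IsBPO (proj₁ A)
      P A = bpo (proj₁ A) (K⊆Q (proj₁ A) (proj₂ A))

-- Δ turns a Σ-term t into an interval term t^Δ whose value at any assignment of intervals is the
-- degenerate interval [t(lower endpoints)]. Hence A ⊨ φ iff 𝓘(A) ⊨ φ^Δ (for ⇐ evaluate at degenerate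
-- intervals [a,a]), and quasi-identities transfer along isomorphisms. So if B ∈ 𝕀ℝ and 𝓘(G B) ≅ B,
-- every axiom φ of ℝ holds in all 𝓘(A) with A ∈ ℝ as φ^Δ, hence in B and in 𝓘(G B), hence in G B:
-- the quasi-inverse G of the equivalence on ℚ maps 𝕀ℝ into ℝ, and restricts.
module Submission where

open import Defs
open import Data.Nat using (ℕ)
open import Data.Product using (_×_; _,_; proj₁; proj₂)
open import Data.List using (map)
import Data.List.Relation.Unary.All as All
open import Data.List.Relation.Unary.All.Properties using (map⁺; map⁻)
open import Function using (_∘_)
open Algebra
open Hom

module _ {S : Signature} where

  hom-eval : ∀ {X} {A B : Algebra S} (h : Hom A B) (env : X → Carrier A) (t : Term S X) →
             _≈_ B (fun h (eval A env t)) (eval B (fun h ∘ env) t)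
  hom-eval {B = B} h env (var x)    = ≈-refl B
  hom-eval {B = B} h env (app f ts) =
    ≈-trans B (preserves h f _) (⟦⟧-cong B f (λ i → hom-eval h env (ts i)))

  hom-holds : ∀ {X} {A B : Algebra S} (h : Hom A B) (env : X → Carrier A) (e : Equation S X) →
              Holds A env e → Holds B (fun h ∘ env) e
  hom-holds {B = B} h env (t , s) p =
    ≈-trans B (≈-sym B (hom-eval h env t)) (≈-trans B (fun-cong h p) (hom-eval h env s))

  iso-reflects-⊨ : ∀ {A B : Algebra S} → Iso A B → ∀ φ → B ⊨ φ → A ⊨ φ
  iso-reflects-⊨ {A} {B} iso φ B⊨φ env premises =
    ≈-trans A (≈-sym A (back t))
      (≈-trans A (hom-holds from (fun to ∘ env) (t , s) conclusionB) (back s))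
    where
    open Iso iso
    t = proj₁ (QuasiIdentity.conclusion φ)
    s = proj₂ (QuasiIdentity.conclusion φ)
    conclusionB = B⊨φ (fun to ∘ env) (All.map (λ {e} → hom-holds to env e) premises)
    back : ∀ u → _≈_ A (eval A (fun from ∘ fun to ∘ env) u) (eval A env u)
    back = eval-cong A (λ x → from∘to (env x))

  generatedBy-reindex : ∀ {J J' : Set₁} (F : J → Algebra S) (r : J' → J) →
                        ∀ B → GeneratedBy (F ∘ r) B → GeneratedBy F B
  generatedBy-reindex F r B B∈ φ F⊨φ = B∈ φ (F⊨φ ∘ r)

module IntervalQuasiIdentities (PS : PolSig) (E : OrderEqs (PolSig.sig PS)) where
  open Interval PS E hiding (hom-eval)
  open PolSig PS using (ρ)

  Δ-term : ∀ {X} → Term Σ₀ X → Term ΣI X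
  Δ-term (var x)    = app Δ (λ _ → var x)
  Δ-term (app f ts) = app (base f) (Δ-term ∘ ts)

  Δ-equation : ∀ {X} → Equation Σ₀ X → Equation ΣI X
  Δ-equation (t , s) = Δ-term t , Δ-term s

  Δ-quasiIdentity : QuasiIdentity Σ₀ → QuasiIdentity ΣI
  Δ-quasiIdentity φ = record
    { premises   = map Δ-equation (QuasiIdentity.premises φ)
    ; conclusion = Δ-equation (QuasiIdentity.conclusion φ) }

  module _ (A : Algebra Σ₀) (P : IsBPO A) where

    lower upper : Carrier (𝓘 A P) → Carrier A
    lower x = proj₁ (proj₁ x)
    upper x = proj₂ (proj₁ x)

    selLo-degenerate : ∀ q {a b c} → _≈_ A a c → _≈_ A b c → _≈_ A (selLo q a b) c
    selLo-degenerate ⊕ a≈c b≈c = a≈c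
    selLo-degenerate ⊖ a≈c b≈c = b≈c

    selHi-degenerate : ∀ q {a b c} → _≈_ A a c → _≈_ A b c → _≈_ A (selHi q a b) c
    selHi-degenerate ⊕ a≈c b≈c = b≈c
    selHi-degenerate ⊖ a≈c b≈c = a≈c

    eval-Δ-term : ∀ {X} (env : X → Carrier (𝓘 A P)) (t : Term Σ₀ X) →
                  _≈_ A (lower (eval (𝓘 A P) env (Δ-term t))) (eval A (lower ∘ env) t) ×
                  _≈_ A (upper (eval (𝓘 A P) env (Δ-term t))) (eval A (lower ∘ env) t)
    eval-Δ-term env (var x)    = ≈-refl A , ≈-refl A
    eval-Δ-term env (app f ts) =
      ⟦⟧-cong A f (λ k → selLo-degenerate (ρ f k) (proj₁ (ih k)) (proj₂ (ih k))) ,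
      ⟦⟧-cong A f (λ k → selHi-degenerate (ρ f k) (proj₁ (ih k)) (proj₂ (ih k)))
      where ih = λ k → eval-Δ-term env (ts k)

    Δ-holds⁻ : ∀ {X} (env : X → Carrier (𝓘 A P)) e →
               Holds (𝓘 A P) env (Δ-equation e) → Holds A (lower ∘ env) e
    Δ-holds⁻ env (t , s) (lower≈ , _) =
      ≈-trans A (≈-sym A (proj₁ (eval-Δ-term env t)))
        (≈-trans A lower≈ (proj₁ (eval-Δ-term env s)))

    Δ-holds⁺ : ∀ {X} (env : X → Carrier (𝓘 A P)) e →
               Holds A (lower ∘ env) e → Holds (𝓘 A P) env (Δ-equation e)
    Δ-holds⁺ env (t , s) p =
      ≈-trans A (proj₁ (eval-Δ-term env t)) (≈-trans A p (≈-sym A (proj₁ (eval-Δ-term env s)))) ,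
      ≈-trans A (proj₂ (eval-Δ-term env t)) (≈-trans A p (≈-sym A (proj₂ (eval-Δ-term env s))))

    ⊨⇒𝓘⊨Δ : ∀ φ → A ⊨ φ → 𝓘 A P ⊨ Δ-quasiIdentity φ
    ⊨⇒𝓘⊨Δ φ A⊨φ env Δ-premises =
      Δ-holds⁺ env conclusion
        (A⊨φ (lower ∘ env) (All.map (λ {e} → Δ-holds⁻ env e) (map⁻ {xs = premises} Δ-premises)))
      where open QuasiIdentity φ

    𝓘⊨Δ⇒⊨ : ∀ φ → 𝓘 A P ⊨ Δ-quasiIdentity φ → A ⊨ φ
    𝓘⊨Δ⇒⊨ φ 𝓘⊨φΔ env premisesA =
      Δ-holds⁻ degenerate conclusion
        (𝓘⊨φΔ degenerate (map⁺ (All.map (λ {e} → Δ-holds⁺ degenerate e) premisesA)))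
      where
      open QuasiIdentity φ
      degenerate : ℕ → Carrier (𝓘 A P)
      degenerate x = (env x , env x) , IsBPO.≤-refl P (env x)

    -- An object of ℝ carries its IsBPO proof through R⊆Q, while G B only has one via ℚ; the two
    -- interval algebras share carrier and operations, so the identity connects them.
    𝓘-proof-irrelevant : (P' : IsBPO A) → Hom (𝓘 A P) (𝓘 A P')
    𝓘-proof-irrelevant P' = record
      { fun       = λ x → x
      ; fun-cong  = λ e → e
      ; preserves = λ { (base f) _ → ≈-refl A , ≈-refl A
                      ; Δ _        → ≈-refl A , ≈-refl A
                      ; ∇ _        → ≈-refl A , ≈-refl A
                      ; ι _        → ≈-refl A , ≈-refl A } }

  module _ (Q : Class Σ₀) (bpo : ∀ A → Q A → IsBPO A)
           (R : Class Σ₀) (R⊆Q : ∀ A → R A → Q A) where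

    𝓘-iso-reflects-membership : IsQuasivariety R → ∀ C (P : IsBPO C) B →
                                𝕀 Q bpo R R⊆Q B → Iso (𝓘 C P) B → R C
    𝓘-iso-reflects-membership (Φ , R≡Mod⟨Φ⟩) C P B B∈𝕀R 𝓘C≅B =
      proj₂ (R≡Mod⟨Φ⟩ C) λ φ Φφ →
        𝓘⊨Δ⇒⊨ C P φ (iso-reflects-⊨ 𝓘C≅B (Δ-quasiIdentity φ)
          (B∈𝕀R (Δ-quasiIdentity φ) λ (A , A∈R) → ⊨⇒𝓘⊨Δ A _ φ (proj₁ (R≡Mod⟨Φ⟩ A) A∈R φ Φφ)))

corollary8p10 : (PS : PolSig) (E : OrderEqs (PolSig.sig PS))
    (Q : Class (PolSig.sig PS)) → IsQuasivariety Q →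
    (bpo : ∀ A → Q A → Interval.IsBPO PS E A) →
    (R : Class (PolSig.sig PS)) → IsQuasivariety R → (R⊆Q : ∀ A → R A → Q A) →
    IsCatEquivalence (Interval.𝓘F PS E Q bpo Q (λ A q → q)) →
    IsCatEquivalence (Interval.𝓘F PS E Q bpo R R⊆Q)
corollary8p10 PS E Q _ bpo R R-quasivariety R⊆Q equivalence = record
  { G     = G∣
  ; η     = λ A → η (proj₁ A , R⊆Q (proj₁ A) (proj₂ A))
  ; η-nat = η-nat
  ; ε     = λ B → record
      { to      = Iso.to (ε (inQ B)) ∘H 𝓘-proof-irrelevant (GA B) _ _
      ; from    = 𝓘-proof-irrelevant (GA B) _ _ ∘H Iso.from (ε (inQ B))
      ; from∘to = Iso.from∘to (ε (inQ B))
      ; to∘from = Iso.to∘from (ε (inQ B)) }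
  ; ε-nat = λ {B} {C} → ε-nat {inQ B} {inQ C}
  }
  where
  open Interval PS E hiding (hom-eval)
  open IntervalQuasiIdentities PS E
  open IsCatEquivalence equivalence
  module G = Functor G
  inQ : Obj (𝕀 Q bpo R R⊆Q) → Obj (𝕀 Q bpo Q (λ A q → q))
  inQ (B , B∈𝕀R) =
    B , generatedBy-reindex (λ (A , A∈Q) → 𝓘 A (bpo A A∈Q)) (λ (A , A∈R) → A , R⊆Q A A∈R) B B∈𝕀R
  GA : Obj (𝕀 Q bpo R R⊆Q) → Algebra Σ₀
  GA B = proj₁ (G.obj (inQ B))
  G∣ : Functor (𝕀 Q bpo R R⊆Q) R
  G∣ = record
    { obj      = λ B → GA B ,
        𝓘-iso-reflects-membership Q bpo R R⊆Q R-quasivariety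
          (GA B) (bpo (GA B) (proj₂ (G.obj (inQ B)))) (proj₁ B) (proj₂ B) (ε (inQ B))
    ; map      = λ {B} {C} → G.map {inQ B} {inQ C}
    ; map-cong = λ {B} {C} → G.map-cong {inQ B} {inQ C}
    ; map-id   = λ {B} → G.map-id {inQ B}
    ; map-∘    = λ {B} {C} {D} → G.map-∘ {inQ B} {inQ C} {inQ D} }
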